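{- A rational number $z$ can be written as the sum of three squares of rational numbers if and only if there exist rational numbers $r,s,t$ such that $z=r^2\left(s^2\left(t^2+1\right)+1\right)$. -}

module Defs where

{-# OPTIONS --safe #-}
module Submission where

-- Expanding, r² (s² (t² + 1) + 1) = (r s t)² + (r s)² + r². Conversely, for a² + b² + c² with
-- c ≠ 0 take r = c: it remains to write (a/c)² + (b/c)² as s² (t² + 1), which is immediate
-- (s = b/c, t = a/b) when b ≠ 0, while a single square u² equals (4u/5)² ((3/4)² + 1) by the
-- Pythagorean triple (3, 4, 5). If c = 0, a nonzero summand is permuted into last place.

open import Defs
open import Data.Rational using (ℚ; _+_; _*_; 1ℚ)
open import Data.Product using (∃; _,_)
open import Relation.Binary.PropositionalEquality using (_≡_)
open import Function.Bundles using (_⇔_)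

open import Algebra.Bundles using (CommutativeMonoid)
open import Data.Integer using (+_)
open import Data.Rational using (0ℚ; _/_; _÷_; 1/_; NonZero; ≢-nonZero)
open import Data.Rational.Properties
  using (_≟_; *-inverseʳ; *-identityʳ; +-0-commutativeMonoid)
open import Data.Rational.Solver using (module +-*-Solver)
open import Function.Bundles using (mk⇔)
open import Relation.Binary.PropositionalEquality
  using (refl; sym; trans; cong; cong₂; subst; _≢_; module ≡-Reasoning)
open import Relation.Nullary using (yes; no)

open import Algebra.Properties.CommutativeSemigroup
  (CommutativeMonoid.commutativeSemigroup +-0-commutativeMonoid) using (xy∙z≈xz∙y; xy∙z≈yz∙x)
open +-*-Solver

SumOfThreeSquares : ℚ → Set
SumOfThreeSquares z = ∃ λ a → ∃ λ b → ∃ λ c → z ≡ a * a + b * b + c * c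

NestedSquareForm : ℚ → Set
NestedSquareForm z = ∃ λ r → ∃ λ s → ∃ λ t → z ≡ r * r * (s * s * (t * t + 1ℚ) + 1ℚ)

nested≡sumOfThreeSquares : ∀ r s t →
  r * r * (s * s * (t * t + 1ℚ) + 1ℚ) ≡ (r * s * t) * (r * s * t) + (r * s) * (r * s) + r * r
nested≡sumOfThreeSquares = solve 3
  (λ r s t → r :* r :* (s :* s :* (t :* t :+ con 1ℚ) :+ con 1ℚ)
           := (r :* s :* t) :* (r :* s :* t) :+ (r :* s) :* (r :* s) :+ r :* r)
  refl

p*[q÷p]≡q : ∀ p q .{{_ : NonZero p}} → p * (q ÷ p) ≡ q
p*[q÷p]≡q p q = begin
  p * (q * 1/ p) ≡⟨ solve 3 (λ p q i → p :* (q :* i) := q :* (p :* i)) refl p q (1/ p) ⟩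
  q * (p * 1/ p) ≡⟨ cong (q *_) (*-inverseʳ p) ⟩
  q * 1ℚ         ≡⟨ *-identityʳ q ⟩
  q              ∎
  where open ≡-Reasoning

sumOfTwoSquares-factor : ∀ u v → ∃ λ s → ∃ λ t → u * u + v * v ≡ s * s * (t * t + 1ℚ)
sumOfTwoSquares-factor u v with v ≟ 0ℚ
... | yes refl = + 4 / 5 * u , + 3 / 4 , solve 1
  (λ u → u :* u :+ con 0ℚ :* con 0ℚ
       := (con (+ 4 / 5) :* u) :* (con (+ 4 / 5) :* u) :* (con (+ 3 / 4) :* con (+ 3 / 4) :+ con 1ℚ))
  refl u
... | no v≢0 = v , u ÷ v , (begin
  u * u + v * v                         ≡⟨ cong (λ w → w * w + v * v) (sym (p*[q÷p]≡q v u)) ⟩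
  (v * t) * (v * t) + v * v             ≡⟨ solve 2 (λ v t → (v :* t) :* (v :* t) :+ v :* v
                                                          := v :* v :* (t :* t :+ con 1ℚ)) refl v t ⟩
  v * v * (t * t + 1ℚ)                  ∎)
  where
  instance _ = ≢-nonZero v≢0
  t = u ÷ v
  open ≡-Reasoning

sumOfThreeSquares[c≢0]⇒nested : ∀ a b c .{{_ : NonZero c}} →
  NestedSquareForm (a * a + b * b + c * c)
sumOfThreeSquares[c≢0]⇒nested a b c with sumOfTwoSquares-factor (a ÷ c) (b ÷ c)
... | s , t , x²+y²≡s²[t²+1] = c , s , t , (begin
  a * a + b * b + c * c                         ≡⟨ cong₂ (λ u w → u * u + w * w + c * c)
                                                     (sym (p*[q÷p]≡q c a)) (sym (p*[q÷p]≡q c b)) ⟩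
  (c * x) * (c * x) + (c * y) * (c * y) + c * c ≡⟨ solve 3
      (λ c x y → (c :* x) :* (c :* x) :+ (c :* y) :* (c :* y) :+ c :* c
               := c :* c :* (x :* x :+ y :* y :+ con 1ℚ)) refl c x y ⟩
  c * c * (x * x + y * y + 1ℚ)                  ≡⟨ cong (λ w → c * c * (w + 1ℚ)) x²+y²≡s²[t²+1] ⟩
  c * c * (s * s * (t * t + 1ℚ) + 1ℚ)           ∎)
  where
  x = a ÷ c
  y = b ÷ c
  open ≡-Reasoning

nested⇒sumOfThreeSquares : ∀ z → NestedSquareForm z → SumOfThreeSquares z
nested⇒sumOfThreeSquares z (r , s , t , eq) =
  r * s * t , r * s , r , trans eq (nested≡sumOfThreeSquares r s t)

sumOfThreeSquares⇒nested : ∀ z → SumOfThreeSquares z → NestedSquareForm z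
sumOfThreeSquares⇒nested z (a , b , c , refl) with c ≟ 0ℚ | b ≟ 0ℚ | a ≟ 0ℚ
... | no c≢0   | _        | _        =
  sumOfThreeSquares[c≢0]⇒nested a b c {{≢-nonZero c≢0}}
... | yes _    | no b≢0   | _        = subst NestedSquareForm (sym (xy∙z≈xz∙y (a * a) (b * b) (c * c)))
  (sumOfThreeSquares[c≢0]⇒nested a c b {{≢-nonZero b≢0}})
... | yes _    | yes _    | no a≢0   = subst NestedSquareForm (sym (xy∙z≈yz∙x (a * a) (b * b) (c * c)))
  (sumOfThreeSquares[c≢0]⇒nested b c a {{≢-nonZero a≢0}})
... | yes refl | yes refl | yes refl = 0ℚ , 0ℚ , 0ℚ , refl

lemma9 : (z : ℚ) →
    (∃ λ a → ∃ λ b → ∃ λ c → z ≡ a * a + b * b + c * c)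
      ⇔ (∃ λ r → ∃ λ s → ∃ λ t → z ≡ r * r * (s * s * (t * t + 1ℚ) + 1ℚ))
lemma9 z = mk⇔ (sumOfThreeSquares⇒nested z) (nested⇒sumOfThreeSquares z)
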